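{- Let $G_0\equiv\overline{A_0}\mid\sigma_0\mid\Delta_0$ be a goal that is not solved, let $(\theta_0,\rho_0)$ be a solution of $G_0$ such that the atoms $\overline{A_0}$ instantiated by $(\theta_0,\rho_0)$ are derivable in $QHL(\mathcal{D})$ from $\mathcal{P}$ using exactly $n$ inference steps in total, and let $V_0$ be any finite set of variables with $\mathrm{var}(G_0)\cup\mathrm{dom}(\theta_0)\subseteq V_0$. Then for any choice of an atom $A\sharp W$ of $\overline{A_0}$ there exists a resolution step $G_0\Rightarrow_{\sigma_1}G_1\equiv\overline{A_1}\mid\sigma_0\sigma_1\mid\Delta_1$ selecting that atom, and a pair $(\theta_1,\rho_1)$ such that: (a) $\theta_1=\theta_0$ on $V_0$; (b) $\sigma_1\theta_1=\theta_1$; (c) $\sigma_0\sigma_1\theta_1=\theta_1$; (d) $\rho_1(W')\sqsupseteq\rho_0(W')$ for all $W'\in\mathrm{war}(G_0)$; (e) $\rho_1$ satisfies every constraint in $\Delta_1$; (f) the atoms $\overline{A_1}$ instantiated by $(\theta_1,\rho_1)$ are derivable in $QHL(\mathcal{D})$ from $\mathcal{P}$ in exactly $n-1$ inference steps. In particular, $(\theta_1,\rho_1)$ is a solution of $G_1$ with $n-1$ inference steps.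
   Context: $\mathcal{D}=\langle D,\sqsubseteq,\bot,\top,\circ\rangle$ is a qualification domain (lattice with extreme points and attenuation operation $\circ$ that is associative, commutative, monotonic, with $d\circ\top=d$, $d\circ\bot=\bot$, and distributing over binary glb); $\mathrm{glb}\,S$ is the greatest lower bound of a finite $S\subseteq D$. $\mathcal{P}$ is a fixed $QLP(\mathcal{D})$ program of clauses $H\xleftarrow{d}B_1,\dots,B_k$, $d\in D\setminus\{\bot\}$; $QHL(\mathcal{D})$ has the single inference rule: from $B_1\theta\sharp d_1,\dots,B_k\theta\sharp d_k$ infer $H\theta\sharp d'$ for a clause of $\mathcal{P}$, substitution $\theta$, and $d'\sqsubseteq d\circ\mathrm{glb}\{d_1,\dots,d_k\}$. A goal is $\overline{A}\mid\sigma\mid\Delta$ with $\overline{A}$ annotated atoms $A\sharp W$, $\sigma$ idempotent with $\mathrm{dom}(\sigma)\cap\mathrm{var}(\overline{A})=\emptyset$, $\Delta$ an admissible set of threshold constraints $\alpha\circ W\sqsupseteq\beta$ (exactly one per qualification variable of $\overline{A}$) and defining constraints $W=d\circ\mathrm{glb}\{W_1,\dots,W_k\}$; $\mathrm{var}(G)=\mathrm{var}(\overline{A})\cup\mathrm{dom}(\sigma)$ and $\mathrm{war}(G)$ is the set of qualification variables of $\overline{A}$ and of $\mathrm{dom}(\Delta)$; a goal is solved if $\overline{A}$ is empty and $\Delta$ has only defining constraints. A resolution step rewrites $\overline{L},A\sharp W,\overline{R}\mid\sigma_0\mid\alpha\circ W\sqsupseteq\beta,\Delta$ into $(\overline{L},B_1\sharp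 W_1,\dots,B_k\sharp W_k,\overline{R})\sigma_1\mid\sigma_0\sigma_1\mid d\circ\alpha\circ W_1\sqsupseteq\beta,\dots,d\circ\alpha\circ W_k\sqsupseteq\beta,W=d\circ\mathrm{glb}\{W_1,\dots,W_k\},\Delta$, using a fresh variant $H\xleftarrow{d}B_1,\dots,B_k$ of a program clause with $d\circ\alpha\sqsupseteq\beta$, $\sigma_1$ a most general unifier of $A$ and $H$, fresh $W_i$. $(\theta,\rho)$ is a solution of $\overline{A}\mid\sigma\mid\Delta$ iff $\theta=\sigma\theta$, $\rho$ satisfies $\Delta$, and $\mathcal{P}\vdash_{QHL(\mathcal{D})}A\theta\sharp W\rho$ for each $A\sharp W$ in $\overline{A}$. -}

module Defs where

open import Data.Nat using (ℕ; zero; suc; _+_; _<_; _≤_; _≟_)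
open import Data.List using (List; []; _∷_; _++_; map; foldr; zip; length; concatMap)
open import Data.List.Membership.Propositional using (_∈_; _∉_)
open import Data.List.Relation.Unary.Any using (Any)
open import Data.List.Relation.Unary.All using (All)
open import Data.List.Relation.Unary.Unique.Propositional using (Unique)
open import Data.Product using (Σ; ∃; ∃-syntax; _×_; _,_; proj₁; proj₂)
open import Data.Sum using (_⊎_)
open import Data.Bool using (if_then_else_)
open import Relation.Nullary using (¬_)
open import Relation.Nullary.Decidable using (⌊_⌋)
open import Relation.Binary.PropositionalEquality using (_≡_; _≢_)
open import Relation.Binary.Structures using (IsPartialOrder)
open import Relation.Binary.Lattice.Definitions using (Infimum; Supremum)
open import Function.Definitions using (Injective)

record QDomain : Set₁ where
  infix  4 _⊑_
  infixr 7 _⊓_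
  infixr 6 _⊔_
  infixr 8 _∘_
  field
    D      : Set
    _⊑_    : D → D → Set
    ⊥ ⊤    : D
    _⊓_    : D → D → D
    _⊔_    : D → D → D
    _∘_    : D → D → D
    isPartialOrder : IsPartialOrder _≡_ _⊑_
    ⊓-glb  : Infimum _⊑_ _⊓_
    ⊔-lub  : Supremum _⊑_ _⊔_
    ⊥-min  : ∀ d → ⊥ ⊑ d
    ⊤-max  : ∀ d → d ⊑ ⊤
    ∘-assoc : ∀ x y z → (x ∘ y) ∘ z ≡ x ∘ (y ∘ z)
    ∘-comm  : ∀ x y → x ∘ y ≡ y ∘ x
    ∘-mono  : ∀ {x x′ y y′} → x ⊑ x′ → y ⊑ y′ → x ∘ y ⊑ x′ ∘ y′
    ∘-⊤     : ∀ d → d ∘ ⊤ ≡ d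
    ∘-⊥     : ∀ d → d ∘ ⊥ ≡ ⊥
    ∘-distrib-⊓ : ∀ d e e′ → d ∘ (e ⊓ e′) ≡ (d ∘ e) ⊓ (d ∘ e′)

  glb : List D → D
  glb = foldr _⊓_ ⊤

-- First-order syntax.  Data variables and qualification variables are
-- natural numbers; function and predicate symbols are natural numbers
-- (any arity).

Var : Set
Var = ℕ

QVar : Set
QVar = ℕ

data Term : Set where
  var : Var → Term
  fun : ℕ → List Term → Term

record Atom : Set where
  constructor atom
  field
    pred : ℕ
    args : List Term

-- substitutions (as total maps; dom σ = { x | σ x ≢ var x })
Subst : Set
Subst = Var → Term

mutual
  _⟪_⟫ : Term → Subst → Term
  var x    ⟪ σ ⟫ = σ x
  fun f ts ⟪ σ ⟫ = fun f (ts ⟪ σ ⟫*)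

  _⟪_⟫* : List Term → Subst → List Term
  []       ⟪ σ ⟫* = []
  (t ∷ ts) ⟪ σ ⟫* = t ⟪ σ ⟫ ∷ ts ⟪ σ ⟫*

_⟪_⟫ₐ : Atom → Subst → Atom
atom p ts ⟪ σ ⟫ₐ = atom p (ts ⟪ σ ⟫*)

-- composition: σ θ  (first σ, then θ)
_⨾_ : Subst → Subst → Subst
(σ ⨾ θ) x = σ x ⟪ θ ⟫

_≐_ : Subst → Subst → Set
σ ≐ θ = ∀ x → σ x ≡ θ x

_∈dom_ : Var → Subst → Set
x ∈dom σ = σ x ≢ var x

FinDom : Subst → Set
FinDom σ = Σ (List Var) λ xs → ∀ x → x ∈dom σ → x ∈ xs

Idempotent : Subst → Set
Idempotent σ = (σ ⨾ σ) ≐ σ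

data _occursIn_ (x : Var) : Term → Set where
  here  : x occursIn var x
  inArg : ∀ {f ts} → Any (x occursIn_) ts → x occursIn fun f ts

_occursInₐ_ : Var → Atom → Set
x occursInₐ atom p ts = Any (x occursIn_) ts

IsMGU : Subst → Atom → Atom → Set
IsMGU σ A H =
  (A ⟪ σ ⟫ₐ ≡ H ⟪ σ ⟫ₐ) ×
  (∀ τ → A ⟪ τ ⟫ₐ ≡ H ⟪ τ ⟫ₐ → Σ Subst λ η → τ ≐ (σ ⨾ η))

module QLP (𝒟 : QDomain) where
  open QDomain 𝒟 public

  record Clause : Set where
    constructor _←⟨_,_⟩_
    field
      head  : Atom
      qual  : D
      qual≢⊥ : qual ≢ ⊥
      body  : List Atom
  open Clause public

  Program : Set
  Program = List Clause

  _occursInᶜ_ : Var → Clause → Set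
  x occursInᶜ C = x occursInₐ head C ⊎ Any (x occursInₐ_) (body C)

  renameClause : (Var → Var) → Clause → Clause
  renameClause η (H ←⟨ d , p ⟩ Bs) =
    (H ⟪ (λ x → var (η x)) ⟫ₐ) ←⟨ d , p ⟩ map (λ B → B ⟪ (λ x → var (η x)) ⟫ₐ) Bs

  IsVariant : Clause → Clause → Set
  IsVariant C′ C = Σ (Var → Var) λ η → Injective _≡_ _≡_ η × (C′ ≡ renameClause η C)

  mutual
    data Derives (P : Program) : Atom → D → ℕ → Set where
      infer : ∀ {C θ d′ ds m} → C ∈ P →
              Premises P (body C) θ ds m →
              d′ ⊑ qual C ∘ glb ds →
              Derives P (head C ⟪ θ ⟫ₐ) d′ (suc m)

    data Premises (P : Program) : List Atom → Subst → List D → ℕ → Set where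
      []  : ∀ {θ} → Premises P [] θ [] 0
      _∷_ : ∀ {B Bs θ d ds n m} →
            Derives P (B ⟪ θ ⟫ₐ) d n → Premises P Bs θ ds m →
            Premises P (B ∷ Bs) θ (d ∷ ds) (n + m)

  data DerivesAll (P : Program) : List (Atom × D) → ℕ → Set where
    []  : DerivesAll P [] 0
    _∷_ : ∀ {A d rest n m} → Derives P A d n → DerivesAll P rest m →
          DerivesAll P ((A , d) ∷ rest) (n + m)

  data Constraint : Set where
    thr : D → QVar → D → Constraint
    def : QVar → D → List QVar → Constraint

  Valuation : Set
  Valuation = QVar → D

  Sat : Valuation → Constraint → Set
  Sat ρ (thr α W β)  = β ⊑ α ∘ ρ W
  Sat ρ (def W d Ws) = ρ W ≡ d ∘ glb (map ρ Ws)

  SatAll : Valuation → List Constraint → Set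
  SatAll ρ Δ = All (Sat ρ) Δ

  countThr : QVar → List Constraint → ℕ
  countThr W [] = 0
  countThr W (thr α V β ∷ Δ) = if ⌊ W ≟ V ⌋ then suc (countThr W Δ) else countThr W Δ
  countThr W (def _ _ _ ∷ Δ) = countThr W Δ

  countDef : QVar → List Constraint → ℕ
  countDef W [] = 0
  countDef W (thr _ _ _ ∷ Δ) = countDef W Δ
  countDef W (def V _ _ ∷ Δ) = if ⌊ W ≟ V ⌋ then suc (countDef W Δ) else countDef W Δ

  cvars : Constraint → List QVar
  cvars (thr _ W _)  = W ∷ []
  cvars (def W _ Ws) = W ∷ Ws

  AnnAtom : Set
  AnnAtom = Atom × QVar

  qvars : List AnnAtom → List QVar
  qvars = map proj₂

  record Admissible (As : List AnnAtom) (Δ : List Constraint) : Set where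
    field
      thr-one   : ∀ W → W ∈ qvars As → countThr W Δ ≡ 1
      thr-only  : ∀ α W β → thr α W β ∈ Δ → W ∈ qvars As
      def-once  : ∀ W → countDef W Δ ≤ 1
      def-notA  : ∀ W → W ∈ qvars As → countDef W Δ ≡ 0
      acyclic   : Σ (QVar → ℕ) λ r →
                  ∀ W d Ws → def W d Ws ∈ Δ → ∀ V → V ∈ Ws → r V < r W

  record Goal : Set where
    constructor ⟨_∣_∣_⟩
    field
      atoms : List AnnAtom
      subst : Subst
      cstrs : List Constraint
  open Goal public

  _∈var_ : Var → Goal → Set
  x ∈var G = Any (λ a → x occursInₐ proj₁ a) (atoms G) ⊎ x ∈dom subst G

  _∈war_ : QVar → Goal → Set
  W ∈war G = W ∈ qvars (atoms G) ⊎ Any (λ c → W ∈ cvars c) (cstrs G)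

  record IsGoal (G : Goal) : Set where
    field
      idem     : Idempotent (subst G)
      findom   : FinDom (subst G)
      disjoint : ∀ x → Any (λ a → x occursInₐ proj₁ a) (atoms G) → subst G x ≡ var x
      qdistinct : Unique (qvars (atoms G))
      admissible : Admissible (atoms G) (cstrs G)

  IsDefining : Constraint → Set
  IsDefining (thr _ _ _) = Data.Empty.⊥ where import Data.Empty
  IsDefining (def _ _ _) = Data.Unit.⊤ where import Data.Unit

  Solved : Goal → Set
  Solved G = (atoms G ≡ []) × All IsDefining (cstrs G)

  inst : Subst → Valuation → List AnnAtom → List (Atom × D)
  inst θ ρ = map (λ a → (proj₁ a ⟪ θ ⟫ₐ , ρ (proj₂ a)))

  applyAnn : List AnnAtom → Subst → List AnnAtom
  applyAnn As σ = map (λ a → (proj₁ a ⟪ σ ⟫ₐ , proj₂ a)) As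

  record ResolutionStep (P : Program) (G₀ : Goal)
                        (L : List AnnAtom) (A : Atom) (W : QVar) (R : List AnnAtom)
                        (σ₁ : Subst) (G₁ : Goal) : Set where
    field
      selected : atoms G₀ ≡ L ++ (A , W) ∷ R
      α β      : D
      Δl Δr    : List Constraint
      split    : cstrs G₀ ≡ Δl ++ thr α W β ∷ Δr
      C C′     : Clause
      C∈P      : C ∈ P
      variant  : IsVariant C′ C
      fresh    : ∀ x → x occursInᶜ C′ → ¬ (x ∈var G₀)
      d∘α⊒β    : β ⊑ qual C′ ∘ α
      mgu      : IsMGU σ₁ A (head C′)
      mgu-fin  : FinDom σ₁
      Ws       : List QVar
      Ws-len   : length Ws ≡ length (body C′)
      Ws-uniq  : Unique Ws
      Ws-fresh : ∀ V → V ∈ Ws → ¬ (V ∈war G₀)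
      result   : G₁ ≡ ⟨ applyAnn (L ++ zip (body C′) Ws ++ R) σ₁
                       ∣ subst G₀ ⨾ σ₁
                       ∣ map (λ V → thr (qual C′ ∘ α) V β) Ws
                           ++ def W (qual C′) Ws ∷ Δl ++ Δr ⟩

module Submission where

-- The last inference in the derivation of the selected atom A♯W uses some clause C under a
-- substitution θc. Renaming C apart by a shift beyond every variable in sight lets θ₀ and the shifted
-- θc be glued into a single θ₁ unifying A with the renamed head, and unification relative to this known
-- unifier gives a finite most general σ₁ with σ₁θ₁ = θ₁. The qualifications ds of the premises go to
-- fresh variables Ws, W gets d ∘ glb ds, and evaluating the acyclic defining constraints upwards gives
-- ρ₁; monotonicity of ∘ and glb makes ρ₁ dominate ρ₀ and satisfy the new thresholds d ∘ α ∘ Wᵢ ⊒ β.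
-- The premises' derivations replace that of A♯W, one inference step fewer.

open import Defs
open import Data.Nat using (ℕ; zero; suc; _+_; _∸_; _≤_; _<_; _≟_; _<?_; s≤s; z≤n)
open import Data.Nat.Properties using (≤-refl; ≤-trans; ≤-pred; ≤-reflexive; +-monoˡ-≤; +-monoʳ-≤; +-assoc; +-suc; m≤m+n; m≤n+m; n≤1+n; <-irrefl; <⇒≤; <-≤-trans; ≮⇒≥; m+n∸m≡n; m+[n∸m]≡n; ≤-totalOrder; suc-injective; <⇒≢; +-cancelˡ-≡)
open import Data.List.Extrema ≤-totalOrder using (max; xs≤max)
open import Data.Nat.Tactic.RingSolver using (solve-∀)
open import Data.List using (List; []; _∷_; _++_; map; length; zip; concat; applyUpTo)
open import Data.List.Relation.Unary.Unique.Propositional using (Unique)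
open import Data.List.Relation.Unary.Unique.Propositional.Properties using (applyUpTo⁺₁)
open import Data.List.Relation.Unary.AllPairs using (_∷_)
open import Data.List.Properties using (∷-injective; map-cong-local; map-++; map-∘; length-map; length-applyUpTo)
open import Data.List.Relation.Unary.Any as Any using (Any; here; there)
import Data.List.Relation.Unary.Any.Properties as Any
open import Data.List.Relation.Unary.All as All using (All; []; _∷_)
open import Data.List.Relation.Unary.All.Properties using (map⁺; map⁻; ++⁺)
open import Data.List.Membership.Propositional using (_∈_; _∉_; lose)
open import Data.List.Membership.Propositional.Properties using (∈-++⁺ˡ; ∈-++⁺ʳ; ∈-applyUpTo⁺; ∈-applyUpTo⁻; ∈-concat⁺; ∈-concat⁺′; ∈-map⁺; ∈-++⁻)
open import Data.Sum using (inj₁; inj₂)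
open import Data.Product using (Σ; _×_; _,_; proj₁; proj₂)
open import Data.Empty using (⊥-elim)
open import Data.Maybe using (Maybe; just; nothing)
open import Relation.Nullary using (¬_; Dec; yes; no)
open import Relation.Binary.Structures using (IsPartialOrder)
open import Relation.Binary.PropositionalEquality as ≡ using (_≡_; _≢_; refl; sym; trans; cong; cong₂; module ≡-Reasoning)

-- Substitutions

mutual
  ⟪⟫-⨾ : ∀ t σ τ → t ⟪ σ ⟫ ⟪ τ ⟫ ≡ t ⟪ σ ⨾ τ ⟫
  ⟪⟫-⨾ (var x)    σ τ = refl
  ⟪⟫-⨾ (fun f ts) σ τ = cong (fun f) (⟪⟫*-⨾ ts σ τ)

  ⟪⟫*-⨾ : ∀ ts σ τ → ts ⟪ σ ⟫* ⟪ τ ⟫* ≡ ts ⟪ σ ⨾ τ ⟫*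
  ⟪⟫*-⨾ []       σ τ = refl
  ⟪⟫*-⨾ (t ∷ ts) σ τ = cong₂ _∷_ (⟪⟫-⨾ t σ τ) (⟪⟫*-⨾ ts σ τ)

⟪⟫ₐ-⨾ : ∀ B σ τ → B ⟪ σ ⟫ₐ ⟪ τ ⟫ₐ ≡ B ⟪ σ ⨾ τ ⟫ₐ
⟪⟫ₐ-⨾ (atom p ts) σ τ = cong (atom p) (⟪⟫*-⨾ ts σ τ)

mutual
  ⟪⟫-cong : ∀ t {σ τ} → (∀ x → x occursIn t → σ x ≡ τ x) → t ⟪ σ ⟫ ≡ t ⟪ τ ⟫
  ⟪⟫-cong (var x)    eq = eq x here
  ⟪⟫-cong (fun f ts) eq = cong (fun f) (⟪⟫*-cong ts (λ x p → eq x (inArg p)))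

  ⟪⟫*-cong : ∀ ts {σ τ} → (∀ x → Any (x occursIn_) ts → σ x ≡ τ x) → ts ⟪ σ ⟫* ≡ ts ⟪ τ ⟫*
  ⟪⟫*-cong []       eq = refl
  ⟪⟫*-cong (t ∷ ts) eq = cong₂ _∷_ (⟪⟫-cong t (λ x p → eq x (here p))) (⟪⟫*-cong ts (λ x p → eq x (there p)))

⟪⟫ₐ-cong : ∀ B {σ τ} → (∀ x → x occursInₐ B → σ x ≡ τ x) → B ⟪ σ ⟫ₐ ≡ B ⟪ τ ⟫ₐ
⟪⟫ₐ-cong (atom p ts) eq = cong (atom p) (⟪⟫*-cong ts eq)

⟪⟫-cong-≐ : ∀ t {σ τ} → σ ≐ τ → t ⟪ σ ⟫ ≡ t ⟪ τ ⟫
⟪⟫-cong-≐ t σ≐τ = ⟪⟫-cong t (λ x _ → σ≐τ x)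

⟪⟫-absorb : ∀ t {σ τ} → (σ ⨾ τ) ≐ τ → t ⟪ σ ⟫ ⟪ τ ⟫ ≡ t ⟪ τ ⟫
⟪⟫-absorb t {σ} {τ} σ⨾τ≐τ = trans (⟪⟫-⨾ t σ τ) (⟪⟫-cong-≐ t σ⨾τ≐τ)

mutual
  ⟪⟫-identity : ∀ t → t ⟪ var ⟫ ≡ t
  ⟪⟫-identity (var x)    = refl
  ⟪⟫-identity (fun f ts) = cong (fun f) (⟪⟫*-identity ts)

  ⟪⟫*-identity : ∀ ts → ts ⟪ var ⟫* ≡ ts
  ⟪⟫*-identity []       = refl
  ⟪⟫*-identity (t ∷ ts) = cong₂ _∷_ (⟪⟫-identity t) (⟪⟫*-identity ts)

mutual
  _occursIn?_ : ∀ x t → Dec (x occursIn t)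
  x occursIn? var y with x ≟ y
  ... | yes refl = yes here
  ... | no x≢y   = no λ { here → x≢y refl }
  x occursIn? fun f ts with x occursIn*? ts
  ... | yes p = yes (inArg p)
  ... | no ¬p = no λ { (inArg p) → ¬p p }

  _occursIn*?_ : ∀ x ts → Dec (Any (x occursIn_) ts)
  x occursIn*? []       = no λ ()
  x occursIn*? (t ∷ ts) with x occursIn? t | x occursIn*? ts
  ... | yes p | _     = yes (here p)
  ... | no _  | yes q = yes (there q)
  ... | no ¬p | no ¬q = no λ { (here p) → ¬p p ; (there q) → ¬q q }

_↦_ : Var → Term → Subst
(x ↦ t) y with y ≟ x
... | yes _ = t
... | no _  = var y

↦-same : ∀ x t → (x ↦ t) x ≡ t
↦-same x t with x ≟ x
... | yes _  = refl
... | no x≢x = ⊥-elim (x≢x refl)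

↦-absorb : ∀ {x t τ} → τ x ≡ t ⟪ τ ⟫ → ((x ↦ t) ⨾ τ) ≐ τ
↦-absorb {x} τx≡tτ y with y ≟ x
... | yes refl = sym τx≡tτ
... | no _     = refl

↦-not-occurring : ∀ {x} u t → ¬ (x occursIn t) → t ⟪ x ↦ u ⟫ ≡ t
↦-not-occurring {x} u t x∉t = trans (⟪⟫-cong t fixes) (⟪⟫-identity t)
  where
  fixes : ∀ y → y occursIn t → (x ↦ u) y ≡ var y
  fixes y y∈t with y ≟ x
  ... | yes refl = ⊥-elim (x∉t y∈t)
  ... | no _     = refl

_≟var_ : ∀ t x → Dec (t ≡ var x)
var y    ≟var x with y ≟ x
... | yes refl = yes refl
... | no y≢x   = no λ { refl → y≢x refl }
fun f ts ≟var x = no λ ()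

-- Unification

infix 6 _≈ₜ_
infix 4 _≈*_

data Equation : Set where
  _≈ₜ_ : Term → Term → Equation
  _≈*_ : List Term → List Term → Equation

Solves : Subst → Equation → Set
Solves τ (s ≈ₜ t)   = s ⟪ τ ⟫ ≡ t ⟪ τ ⟫
Solves τ (ss ≈* ts) = ss ⟪ τ ⟫* ≡ ts ⟪ τ ⟫*

_⟪_⟫ₑ : Equation → Subst → Equation
(s ≈ₜ t)   ⟪ σ ⟫ₑ = s ⟪ σ ⟫ ≈ₜ t ⟪ σ ⟫
(ss ≈* ts) ⟪ σ ⟫ₑ = ss ⟪ σ ⟫* ≈* ts ⟪ σ ⟫*

Solves-⟪⟫ₑ⁻ : ∀ e {σ τ} → Solves τ (e ⟪ σ ⟫ₑ) → Solves (σ ⨾ τ) e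
Solves-⟪⟫ₑ⁻ (s ≈ₜ t)   {σ} {τ} eq = trans (sym (⟪⟫-⨾ s σ τ)) (trans eq (⟪⟫-⨾ t σ τ))
Solves-⟪⟫ₑ⁻ (ss ≈* ts) {σ} {τ} eq = trans (sym (⟪⟫*-⨾ ss σ τ)) (trans eq (⟪⟫*-⨾ ts σ τ))

Solves-⟪⟫ₑ⁺ : ∀ e {σ τ} → Solves (σ ⨾ τ) e → Solves τ (e ⟪ σ ⟫ₑ)
Solves-⟪⟫ₑ⁺ (s ≈ₜ t)   {σ} {τ} eq = trans (⟪⟫-⨾ s σ τ) (trans eq (sym (⟪⟫-⨾ t σ τ)))
Solves-⟪⟫ₑ⁺ (ss ≈* ts) {σ} {τ} eq = trans (⟪⟫*-⨾ ss σ τ) (trans eq (sym (⟪⟫*-⨾ ts σ τ)))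

Solves-≐ : ∀ e {σ τ} → σ ≐ τ → Solves σ e → Solves τ e
Solves-≐ (s ≈ₜ t)   σ≐τ eq = trans (sym (⟪⟫-cong-≐ s σ≐τ)) (trans eq (⟪⟫-cong-≐ t σ≐τ))
Solves-≐ (ss ≈* ts) σ≐τ eq = trans (sym (⟪⟫*-cong ss λ x _ → σ≐τ x)) (trans eq (⟪⟫*-cong ts λ x _ → σ≐τ x))

SolvesAll : Subst → List Equation → Set
SolvesAll τ = All (Solves τ)

record MostGeneralSolution (E : List Equation) : Set where
  field
    mgs     : Subst
    solves  : SolvesAll mgs E
    general : ∀ τ → SolvesAll τ E → τ ≐ (mgs ⨾ τ)
    finite  : FinDom mgs

module _ {E F : List Equation} where
  open MostGeneralSolution

  MostGeneralSolution-transport : (∀ {τ} → SolvesAll τ E → SolvesAll τ F) →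
    (∀ {τ} → SolvesAll τ F → SolvesAll τ E) →
    MostGeneralSolution E → MostGeneralSolution F
  MostGeneralSolution-transport E⇒F F⇒E S = record
    { mgs = mgs S ; solves = E⇒F (solves S) ; general = λ τ τF → general S τ (F⇒E τF) ; finite = finite S }

MostGeneralSolution-[] : MostGeneralSolution []
MostGeneralSolution-[] = record
  { mgs = var ; solves = [] ; general = λ _ _ _ → refl ; finite = [] , λ x x≢x → ⊥-elim (x≢x refl) }

MostGeneralSolution-eliminate : ∀ {x t E} → ¬ (x occursIn t) →
  MostGeneralSolution (map (_⟪ x ↦ t ⟫ₑ) E) → MostGeneralSolution (var x ≈ₜ t ∷ E)
MostGeneralSolution-eliminate {x} {t} {E} x∉t S = record
  { mgs = σ ; solves = σ-solves-x ∷ σ-solves-E ; general = general′ ; finite = finite′ }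
  where
  open MostGeneralSolution S
  σ : Subst
  σ = (x ↦ t) ⨾ mgs

  σ-solves-x : σ x ≡ t ⟪ σ ⟫
  σ-solves-x = begin
    (x ↦ t) x ⟪ mgs ⟫      ≡⟨ cong (_⟪ mgs ⟫) (↦-same x t) ⟩
    t ⟪ mgs ⟫               ≡⟨ cong (_⟪ mgs ⟫) (↦-not-occurring t t x∉t) ⟨
    t ⟪ x ↦ t ⟫ ⟪ mgs ⟫     ≡⟨ ⟪⟫-⨾ t (x ↦ t) mgs ⟩
    t ⟪ σ ⟫                 ∎
    where open ≡-Reasoning

  σ-solves-E : SolvesAll σ E
  σ-solves-E = All.map (λ {e} → Solves-⟪⟫ₑ⁻ e) (map⁻ solves)

  general′ : ∀ τ → SolvesAll τ (var x ≈ₜ t ∷ E) → τ ≐ (σ ⨾ τ)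
  general′ τ (τx≡tτ ∷ τE) y = begin
    τ y                         ≡⟨ ↦-absorb τx≡tτ y ⟨
    (x ↦ t) y ⟪ τ ⟫             ≡⟨ ⟪⟫-cong-≐ ((x ↦ t) y) (general τ τ-solves-Eσ) ⟩
    (x ↦ t) y ⟪ mgs ⨾ τ ⟫       ≡⟨ ⟪⟫-⨾ ((x ↦ t) y) mgs τ ⟨
    (σ ⨾ τ) y                   ∎
    where
    open ≡-Reasoning
    τ-solves-Eσ : SolvesAll τ (map (_⟪ x ↦ t ⟫ₑ) E)
    τ-solves-Eσ = map⁺ (All.map (λ {e} τe → Solves-⟪⟫ₑ⁺ e (Solves-≐ e (λ z → sym (↦-absorb τx≡tτ z)) τe)) τE)

  finite′ : FinDom σ
  finite′ with finite
  ... | xs , dom⊆xs = x ∷ xs , covers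
    where
    covers : ∀ y → y ∈dom σ → y ∈ x ∷ xs
    covers y y∈dom with y ≟ x
    ... | yes y≡x = here y≡x
    ... | no _    = there (dom⊆xs y y∈dom)

MostGeneralSolution-trivial : ∀ {e E} → (∀ τ → Solves τ e) → MostGeneralSolution E → MostGeneralSolution (e ∷ E)
MostGeneralSolution-trivial {e} τe = MostGeneralSolution-transport (λ {τ} τE → τe τ ∷ τE) All.tail

MostGeneralSolution-swap : ∀ {s t E} → MostGeneralSolution (s ≈ₜ t ∷ E) → MostGeneralSolution (t ≈ₜ s ∷ E)
MostGeneralSolution-swap = MostGeneralSolution-transport swap swap
  where
  swap : ∀ {τ s t E} → SolvesAll τ (s ≈ₜ t ∷ E) → SolvesAll τ (t ≈ₜ s ∷ E)
  swap (eq ∷ τE) = sym eq ∷ τE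

mutual
  size : Term → ℕ
  size (var x)    = 1
  size (fun f ts) = suc (size* ts)

  size* : List Term → ℕ
  size* []       = 1
  size* (t ∷ ts) = suc (size t + size* ts)

mutual
  occurs-size : ∀ {x} t σ → x occursIn t → size (σ x) ≤ size (t ⟪ σ ⟫)
  occurs-size (var x)    σ here      = ≤-refl
  occurs-size (fun f ts) σ (inArg p) = ≤-trans (<⇒≤ (occurs*-size ts σ p)) (n≤1+n _)

  occurs*-size : ∀ {x} ts σ → Any (x occursIn_) ts → size (σ x) < size* (ts ⟪ σ ⟫*)
  occurs*-size (t ∷ ts) σ (here p)  = s≤s (≤-trans (occurs-size t σ p) (m≤m+n _ _))
  occurs*-size (t ∷ ts) σ (there p) = ≤-trans (occurs*-size ts σ p) (≤-trans (m≤n+m _ _) (n≤1+n _))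

occurs-solved : ∀ {x t σ} → x occursIn t → σ x ≡ t ⟪ σ ⟫ → t ≡ var x
occurs-solved here                    _  = refl
occurs-solved {t = fun f ts} {σ} (inArg p) eq =
  ⊥-elim (<-irrefl refl (≤-trans (occurs*-size ts σ p) (≤-trans (n≤1+n _) (≤-reflexive (sym (cong size eq))))))

fun-injective : ∀ {f g ss ts} → fun f ss ≡ fun g ts → f ≡ g × ss ≡ ts
fun-injective refl = refl , refl

-- Unification of a system known to have the solution θ. The termination measure is the size of the
-- θ-instance of the system: eliminating x ↦ t leaves it unchanged since θ x = t θ, and every other
-- step deletes or decomposes an equation.
module Solve (θ : Subst) where

  weight : Equation → ℕ
  weight (s ≈ₜ t)   = size (s ⟪ θ ⟫) + size (t ⟪ θ ⟫)
  weight (ss ≈* ts) = size* (ss ⟪ θ ⟫*) + size* (ts ⟪ θ ⟫*)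

  weights : List Equation → ℕ
  weights []      = 0
  weights (e ∷ E) = weight e + weights E

  weight-positive : ∀ e → 0 < weight e
  weight-positive (var x ≈ₜ t)    = ≤-trans (size-positive (θ x)) (m≤m+n _ _)
    where
    size-positive : ∀ t → 0 < size t
    size-positive (var _)   = s≤s z≤n
    size-positive (fun _ _) = s≤s z≤n
  weight-positive (fun f ss ≈ₜ t) = s≤s z≤n
  weight-positive ([] ≈* ts)      = s≤s z≤n
  weight-positive (s ∷ ss ≈* ts) = s≤s z≤n

  weight-⟪⟫ₑ : ∀ {σ} → (σ ⨾ θ) ≐ θ → ∀ e → weight (e ⟪ σ ⟫ₑ) ≡ weight e
  weight-⟪⟫ₑ σ⨾θ≐θ (s ≈ₜ t) = cong₂ _+_ (cong size (⟪⟫-absorb s σ⨾θ≐θ)) (cong size (⟪⟫-absorb t σ⨾θ≐θ))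
  weight-⟪⟫ₑ {σ} σ⨾θ≐θ (ss ≈* ts) = cong₂ _+_ (cong size* (absorb* ss)) (cong size* (absorb* ts))
    where
    absorb* : ∀ us → us ⟪ σ ⟫* ⟪ θ ⟫* ≡ us ⟪ θ ⟫*
    absorb* us = trans (⟪⟫*-⨾ us σ θ) (⟪⟫*-cong us (λ x _ → σ⨾θ≐θ x))

  weights-⟪⟫ₑ : ∀ {σ} → (σ ⨾ θ) ≐ θ → ∀ E → weights (map (_⟪ σ ⟫ₑ) E) ≡ weights E
  weights-⟪⟫ₑ σ⨾θ≐θ []      = refl
  weights-⟪⟫ₑ σ⨾θ≐θ (e ∷ E) = cong₂ _+_ (weight-⟪⟫ₑ σ⨾θ≐θ e) (weights-⟪⟫ₑ σ⨾θ≐θ E)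

  shrink : ∀ {a b w k} → a < b → b + w < suc k → a + w < k
  shrink {w = w} a<b b+w<1+k = ≤-trans (+-monoˡ-≤ w a<b) (≤-pred b+w<1+k)

  decompose-fun : ∀ {f ss ts} → weight (ss ≈* ts) < weight (fun f ss ≈ₜ fun f ts)
  decompose-fun {ss = ss} = s≤s (+-monoʳ-≤ (size* (ss ⟪ θ ⟫*)) (n≤1+n _))

  decompose-∷ : ∀ {s ss t ts} → weight (s ≈ₜ t) + weight (ss ≈* ts) < weight (s ∷ ss ≈* t ∷ ts)
  decompose-∷ {s} {ss} {t} {ts} = ≤-trans (n≤1+n _) (≤-reflexive
    (identity (size (s ⟪ θ ⟫)) (size (t ⟪ θ ⟫)) (size* (ss ⟪ θ ⟫*)) (size* (ts ⟪ θ ⟫*))))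
    where
    identity : ∀ a c S T → suc (suc (a + c + (S + T))) ≡ suc (a + S) + suc (c + T)
    identity = solve-∀

  mutual
    solve : ∀ k E → SolvesAll θ E → weights E < k → MostGeneralSolution E
    solve (suc k) [] _ _ = MostGeneralSolution-[]
    solve (suc k) (var x ≈ₜ t ∷ E) (eq ∷ θE) bound =
      solve-var k eq θE (shrink (weight-positive (var x ≈ₜ t)) bound)
    solve (suc k) (fun f ss ≈ₜ var x ∷ E) (eq ∷ θE) bound =
      MostGeneralSolution-swap (solve-var k (sym eq) θE (shrink (weight-positive (fun f ss ≈ₜ var x)) bound))
    solve (suc k) (fun f ss ≈ₜ fun g ts ∷ E) (eq ∷ θE) bound with fun-injective eq
    ... | refl , args-eq = MostGeneralSolution-transport
            (λ { (τargs ∷ τE) → cong (fun f) τargs ∷ τE })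
            (λ { (τfun ∷ τE) → proj₂ (fun-injective τfun) ∷ τE })
            (solve k ((ss ≈* ts) ∷ E) (args-eq ∷ θE) (shrink (decompose-fun {f} {ss} {ts}) bound))
    solve (suc k) (([] ≈* []) ∷ E) (_ ∷ θE) bound =
      MostGeneralSolution-trivial (λ _ → refl) (solve k E θE (shrink (weight-positive ([] ≈* [])) bound))
    solve (suc k) ((s ∷ ss ≈* t ∷ ts) ∷ E) (eq ∷ θE) bound = MostGeneralSolution-transport
      (λ { (τhd ∷ τtl ∷ τE) → cong₂ _∷_ τhd τtl ∷ τE })
      (λ { (τ∷ ∷ τE) → proj₁ (∷-injective τ∷) ∷ proj₂ (∷-injective τ∷) ∷ τE })
      (solve k (s ≈ₜ t ∷ (ss ≈* ts) ∷ E) (proj₁ (∷-injective eq) ∷ proj₂ (∷-injective eq) ∷ θE)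
        (≡.subst (_< k) (+-assoc (weight (s ≈ₜ t)) _ (weights E)) (shrink (decompose-∷ {s} {ss} {t} {ts}) bound)))

    solve-var : ∀ k {x t E} → θ x ≡ t ⟪ θ ⟫ → SolvesAll θ E → weights E < k →
                MostGeneralSolution (var x ≈ₜ t ∷ E)
    solve-var k {x} {t} {E} eq θE bound with x occursIn? t
    ... | yes x∈t rewrite occurs-solved x∈t eq =
      MostGeneralSolution-trivial (λ _ → refl) (solve k E θE bound)
    ... | no x∉t = MostGeneralSolution-eliminate x∉t
      (solve k (map (_⟪ x ↦ t ⟫ₑ) E) θEσ (≡.subst (_< k) (sym (weights-⟪⟫ₑ (↦-absorb eq) E)) bound))
      where
      θEσ : SolvesAll θ (map (_⟪ x ↦ t ⟫ₑ) E)
      θEσ = map⁺ (All.map (λ {e} θe → Solves-⟪⟫ₑ⁺ e (Solves-≐ e (λ z → sym (↦-absorb eq z)) θe)) θE)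

atom-injective : ∀ {p q ts us} → atom p ts ≡ atom q us → p ≡ q × ts ≡ us
atom-injective refl = refl , refl

record MostGeneralUnifier (θ : Subst) (A H : Atom) : Set where
  field
    mgu      : Subst
    isMGU    : IsMGU mgu A H
    finite   : FinDom mgu
    factors  : θ ≐ (mgu ⨾ θ)

unify : ∀ {θ} A H → A ⟪ θ ⟫ₐ ≡ H ⟪ θ ⟫ₐ → MostGeneralUnifier θ A H
unify {θ} (atom p ts) (atom q us) eq with atom-injective eq
... | refl , args-eq = record
  { mgu      = mgs
  ; isMGU    = cong (atom p) (All.head solves) , λ τ τ-unifies → τ , general τ (cong Atom.args τ-unifies ∷ [])
  ; finite   = finite
  ; factors  = general θ (args-eq ∷ []) }
  where
  open Solve θ
  open MostGeneralSolution (solve _ ((ts ≈* us) ∷ []) (args-eq ∷ []) ≤-refl)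

-- Variables and renaming apart

mutual
  occurs-⟪⟫ : ∀ {x} t σ → x occursIn (t ⟪ σ ⟫) → Σ Var λ y → y occursIn t × x occursIn σ y
  occurs-⟪⟫ (var y)    σ p         = y , here , p
  occurs-⟪⟫ (fun f ts) σ (inArg p) with occurs*-⟪⟫ ts σ p
  ... | y , q , r = y , inArg q , r

  occurs*-⟪⟫ : ∀ {x} ts σ → Any (x occursIn_) (ts ⟪ σ ⟫*) → Σ Var λ y → Any (y occursIn_) ts × x occursIn σ y
  occurs*-⟪⟫ (t ∷ ts) σ (here p) with occurs-⟪⟫ t σ p
  ... | y , q , r = y , here q , r
  occurs*-⟪⟫ (t ∷ ts) σ (there p) with occurs*-⟪⟫ ts σ p
  ... | y , q , r = y , there q , r

occursₐ-⟪⟫ : ∀ {x} B σ → x occursInₐ (B ⟪ σ ⟫ₐ) → Σ Var λ y → y occursInₐ B × x occursIn σ y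
occursₐ-⟪⟫ (atom p ts) = occurs*-⟪⟫ ts

occursₐ-renamed : ∀ {x} (η : Var → Var) B → x occursInₐ (B ⟪ (λ z → var (η z)) ⟫ₐ) → Σ Var λ y → y occursInₐ B × x ≡ η y
occursₐ-renamed η B x∈B with occursₐ-⟪⟫ B (λ z → var (η z)) x∈B
... | y , y∈B , x∈ηy = y , y∈B , var-occurs x∈ηy
  where
  var-occurs : ∀ {x y} → x occursIn var y → x ≡ y
  var-occurs here = refl

occurs-renamed-body : ∀ {x} (η : Var → Var) Bs → Any (x occursInₐ_) (map (_⟪ (λ z → var (η z)) ⟫ₐ) Bs) →
                     Σ Var λ y → Any (y occursInₐ_) Bs × x ≡ η y
occurs-renamed-body η (B ∷ Bs) (here x∈B) with occursₐ-renamed η B x∈B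
... | y , y∈B , x≡ηy = y , here y∈B , x≡ηy
occurs-renamed-body η (B ∷ Bs) (there x∈Bs) with occurs-renamed-body η Bs x∈Bs
... | y , y∈Bs , x≡ηy = y , there y∈Bs , x≡ηy

mutual
  vars : Term → List Var
  vars (var x)    = x ∷ []
  vars (fun f ts) = vars* ts

  vars* : List Term → List Var
  vars* []       = []
  vars* (t ∷ ts) = vars t ++ vars* ts

mutual
  occurs⇒∈vars : ∀ {x} t → x occursIn t → x ∈ vars t
  occurs⇒∈vars (var x)    here      = here refl
  occurs⇒∈vars (fun f ts) (inArg p) = occurs*⇒∈vars* ts p

  occurs*⇒∈vars* : ∀ {x} ts → Any (x occursIn_) ts → x ∈ vars* ts
  occurs*⇒∈vars* (t ∷ ts) (here p)  = ∈-++⁺ˡ (occurs⇒∈vars t p)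
  occurs*⇒∈vars* (t ∷ ts) (there p) = ∈-++⁺ʳ (vars t) (occurs*⇒∈vars* ts p)

varsₐ : Atom → List Var
varsₐ (atom p ts) = vars* ts

above : List ℕ → ℕ
above xs = suc (max 0 xs)

∈⇒<above : ∀ {x xs} → x ∈ xs → x < above xs
∈⇒<above {xs = xs} x∈xs = s≤s (All.lookup (xs≤max 0 xs) x∈xs)

splice : ℕ → ℕ → Subst → Subst → Subst
splice N K θ θ′ x with x <? N
... | yes _ = θ x
... | no _ with x ∸ N <? K
...   | yes _ = θ′ (x ∸ N)
...   | no _  = var x

splice-below : ∀ {N K θ θ′ x} → x < N → splice N K θ θ′ x ≡ θ x
splice-below {N} {x = x} x<N with x <? N
... | yes _  = refl
... | no x≮N = ⊥-elim (x≮N x<N)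

splice-shifted : ∀ {N K θ θ′ y} → y < K → splice N K θ θ′ (N + y) ≡ θ′ y
splice-shifted {N} {K} {θ′ = θ′} {y} y<K with N + y <? N
... | yes N+y<N = ⊥-elim (<-irrefl refl (<-≤-trans N+y<N (m≤m+n N y)))
... | no _ with N + y ∸ N <? K
...   | yes _  = cong θ′ (m+n∸m≡n N y)
...   | no y≮K = ⊥-elim (y≮K (≡.subst (_< K) (sym (m+n∸m≡n N y)) y<K))

splice-FinDom : ∀ {N K θ θ′} → FinDom θ → FinDom (splice N K θ θ′)
splice-FinDom {N} {K} {θ} {θ′} (xs , dom⊆xs) = xs ++ applyUpTo (N +_) K , covers
  where
  covers : ∀ x → x ∈dom (splice N K θ θ′) → x ∈ xs ++ applyUpTo (N +_) K
  covers x x∈dom with x <? N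
  ... | yes _  = ∈-++⁺ˡ (dom⊆xs x x∈dom)
  ... | no x≮N with x ∸ N <? K
  ...   | yes x∸N<K = ∈-++⁺ʳ xs (≡.subst (_∈ applyUpTo (N +_) K) (m+[n∸m]≡n (≮⇒≥ x≮N)) (∈-applyUpTo⁺ (N +_) x∸N<K))
  ...   | no _      = ⊥-elim (x∈dom refl)

∈-applyUpTo-+⁻ : ∀ {M k x} → x ∈ applyUpTo (M +_) k → M ≤ x
∈-applyUpTo-+⁻ {M} x∈ with ∈-applyUpTo⁻ (M +_) x∈
... | i , _ , refl = m≤m+n M i

applyUpTo-+-unique : ∀ M k → Unique (applyUpTo (M +_) k)
applyUpTo-+-unique M k = applyUpTo⁺₁ (M +_) k (λ i<j _ eq → <⇒≢ i<j (+-cancelˡ-≡ M _ _ eq))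

Unique-∉ : ∀ {A : Set} xs {y : A} zs → Unique (xs ++ y ∷ zs) → y ∉ xs ++ zs
Unique-∉ []       zs (y∉zs ∷ _) y∈zs         = All.lookup y∉zs y∈zs refl
Unique-∉ (x ∷ xs) zs (x∉ ∷ _)   (here y≡x)   = All.lookup x∉ (∈-++⁺ʳ xs (here refl)) (sym y≡x)
Unique-∉ (x ∷ xs) zs (_ ∷ u)    (there y∈)   = Unique-∉ xs zs u y∈

_[_≔_] : {A : Set} → (QVar → A) → QVar → A → (QVar → A)
(f [ W ≔ a ]) V with V ≟ W
... | yes _ = a
... | no _  = f V

≔-same : ∀ {A : Set} (f : QVar → A) W a → (f [ W ≔ a ]) W ≡ a
≔-same f W a with W ≟ W
... | yes _  = refl
... | no W≢W = ⊥-elim (W≢W refl)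

≔-other : ∀ {A : Set} (f : QVar → A) {W V} a → V ≢ W → (f [ W ≔ a ]) V ≡ f V
≔-other f {W} {V} a V≢W with V ≟ W
... | yes V≡W = ⊥-elim (V≢W V≡W)
... | no _    = refl

_[_≔*_] : {A : Set} → (QVar → A) → List QVar → List A → (QVar → A)
f [ W ∷ Ws ≔* a ∷ as ] = (f [ Ws ≔* as ]) [ W ≔ a ]
f [ _      ≔* _      ] = f

≔*-∉ : ∀ {A : Set} (f : QVar → A) {V} Ws as → V ∉ Ws → (f [ Ws ≔* as ]) V ≡ f V
≔*-∉ f []       as       V∉Ws = refl
≔*-∉ f (W ∷ Ws) []       V∉Ws = refl
≔*-∉ f (W ∷ Ws) (a ∷ as) V∉Ws =
  trans (≔-other (f [ Ws ≔* as ]) a (λ V≡W → V∉Ws (here V≡W))) (≔*-∉ f Ws as (λ V∈Ws → V∉Ws (there V∈Ws)))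

≔*-map : ∀ {A : Set} (f : QVar → A) Ws as → Unique Ws → length Ws ≡ length as → map (f [ Ws ≔* as ]) Ws ≡ as
≔*-map f []       []       _            _   = refl
≔*-map f (W ∷ Ws) (a ∷ as) (W∉Ws ∷ uWs) len = cong₂ _∷_ (≔-same (f [ Ws ≔* as ]) W a) (begin
  map (f [ W ∷ Ws ≔* a ∷ as ]) Ws  ≡⟨ map-cong-local (All.map (λ W≢V → ≔-other (f [ Ws ≔* as ]) a (λ V≡W → W≢V (sym V≡W))) W∉Ws) ⟩
  map (f [ Ws ≔* as ]) Ws          ≡⟨ ≔*-map f Ws as uWs (suc-injective len) ⟩
  as                               ∎)
  where open ≡-Reasoning

-- Qualifications, derivations and constraints

module _ {𝒟 : QDomain} where
  open QLP 𝒟 hiding (subst)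
  open IsPartialOrder isPartialOrder using () renaming (refl to ⊑-refl; trans to ⊑-trans; reflexive to ⊑-reflexive)

  glb-lower : ∀ {d} ds → d ∈ ds → glb ds ⊑ d
  glb-lower (d ∷ ds) (here refl) = proj₁ (⊓-glb d (glb ds))
  glb-lower (e ∷ ds) (there d∈ds) = ⊑-trans (proj₁ (proj₂ (⊓-glb e (glb ds)))) (glb-lower ds d∈ds)

  glb-mono : ∀ {A : Set} {f g : A → D} xs → All (λ x → f x ⊑ g x) xs → glb (map f xs) ⊑ glb (map g xs)
  glb-mono []       []             = ⊑-refl
  glb-mono {f = f} {g} (x ∷ xs) (fx⊑gx ∷ fxs⊑gxs) =
    proj₂ (proj₂ (⊓-glb (g x) (glb (map g xs)))) _
      (⊑-trans (proj₁ (⊓-glb (f x) _)) fx⊑gx)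
      (⊑-trans (proj₁ (proj₂ (⊓-glb (f x) _))) (glb-mono xs fxs⊑gxs))

  ∘-⊑ˡ : ∀ a b → a ∘ b ⊑ a
  ∘-⊑ˡ a b = ⊑-trans (∘-mono ⊑-refl (⊤-max b)) (⊑-reflexive (∘-⊤ a))

  varsᶜ : Clause → List Var
  varsᶜ C = varsₐ (head C) ++ concat (map varsₐ (body C))

  occursᶜ⇒∈varsᶜ : ∀ {x} C → x occursInᶜ C → x ∈ varsᶜ C
  occursᶜ⇒∈varsᶜ (atom p ts ←⟨ _ , _ ⟩ Bs) (inj₁ x∈H) = ∈-++⁺ˡ (occurs*⇒∈vars* ts x∈H)
  occursᶜ⇒∈varsᶜ (H ←⟨ _ , _ ⟩ Bs) (inj₂ x∈Bs) =
    ∈-++⁺ʳ (varsₐ H) (∈-concat⁺ (Any.map⁺ (Any.map (λ {B} → occursₐ⇒∈varsₐ B) x∈Bs)))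
    where
    occursₐ⇒∈varsₐ : ∀ {x} B → x occursInₐ B → x ∈ varsₐ B
    occursₐ⇒∈varsₐ (atom p ts) = occurs*⇒∈vars* ts

  occurs-renameClause : ∀ {x} η C → x occursInᶜ renameClause η C → Σ Var λ y → y occursInᶜ C × x ≡ η y
  occurs-renameClause η (H ←⟨ _ , _ ⟩ Bs) (inj₁ x∈H) with occursₐ-renamed η H x∈H
  ... | y , y∈H , x≡ηy = y , inj₁ y∈H , x≡ηy
  occurs-renameClause η (H ←⟨ _ , _ ⟩ Bs) (inj₂ x∈Bs) with occurs-renamed-body η Bs x∈Bs
  ... | y , y∈Bs , x≡ηy = y , inj₂ y∈Bs , x≡ηy

  inst-applyAnn : ∀ {θ σ} ρ → (σ ⨾ θ) ≐ θ → ∀ xs → inst θ ρ (applyAnn xs σ) ≡ inst θ ρ xs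
  inst-applyAnn ρ σ⨾θ≐θ [] = refl
  inst-applyAnn {θ} {σ} ρ σ⨾θ≐θ ((B , V) ∷ xs) =
    cong₂ _∷_ (cong (_, ρ V) (trans (⟪⟫ₐ-⨾ B σ θ) (⟪⟫ₐ-cong B (λ x _ → σ⨾θ≐θ x)))) (inst-applyAnn ρ σ⨾θ≐θ xs)

  inst-zip : ∀ θ ρ Bs Ws → inst θ ρ (zip Bs Ws) ≡ zip (map (_⟪ θ ⟫ₐ) Bs) (map ρ Ws)
  inst-zip θ ρ []       Ws       = refl
  inst-zip θ ρ (B ∷ Bs) []       = refl
  inst-zip θ ρ (B ∷ Bs) (V ∷ Ws) = cong (_ ∷_) (inst-zip θ ρ Bs Ws)

  inst-cong : ∀ {θ θ′ ρ ρ′} xs → All (λ a → proj₁ a ⟪ θ ⟫ₐ ≡ proj₁ a ⟪ θ′ ⟫ₐ × ρ (proj₂ a) ≡ ρ′ (proj₂ a)) xs →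
              inst θ ρ xs ≡ inst θ′ ρ′ xs
  inst-cong xs eqs = map-cong-local (All.map (λ (atom-eq , qual-eq) → cong₂ _,_ atom-eq qual-eq) eqs)

  module _ {P : Program} where

    DerivesAll-++⁺ : ∀ {xs ys m n} → DerivesAll P xs m → DerivesAll P ys n → DerivesAll P (xs ++ ys) (m + n)
    DerivesAll-++⁺ []                                 dys = dys
    DerivesAll-++⁺ {n = n} (_∷_ {n = k} {m = m} dx dxs) dys =
      ≡.subst (DerivesAll P _) (sym (+-assoc k m n)) (dx ∷ DerivesAll-++⁺ dxs dys)

    DerivesAll-++⁻ : ∀ xs {ys n} → DerivesAll P (xs ++ ys) n →
                     Σ ℕ λ m → Σ ℕ λ k → DerivesAll P xs m × DerivesAll P ys k × n ≡ m + k
    DerivesAll-++⁻ []       dys       = 0 , _ , [] , dys , refl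
    DerivesAll-++⁻ (x ∷ xs) (dx ∷ dr) with DerivesAll-++⁻ xs dr
    ... | m , k , dxs , dys , eq = _ , k , dx ∷ dxs , dys , trans (cong (_ +_) eq) (sym (+-assoc _ m k))

    Premises⇒DerivesAll : ∀ {Bs θ ds m} → Premises P Bs θ ds m → DerivesAll P (zip (map (_⟪ θ ⟫ₐ) Bs) ds) m
    Premises⇒DerivesAll []       = []
    Premises⇒DerivesAll (d ∷ ps) = d ∷ Premises⇒DerivesAll ps

    Premises-length : ∀ {Bs θ ds m} → Premises P Bs θ ds m → length ds ≡ length Bs
    Premises-length []       = refl
    Premises-length (_ ∷ ps) = cong suc (Premises-length ps)

    record SelectedDerivation (xs : List (Atom × D)) (X : Atom) (d : D) (ys : List (Atom × D)) (n : ℕ) : Set where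
      field
        clause     : Clause
        clause∈P   : clause ∈ P
        θ          : Subst
        ds         : List D
        m nL nR    : ℕ
        left       : DerivesAll P xs nL
        premises   : Premises P (body clause) θ ds m
        right      : DerivesAll P ys nR
        qual-bound : d ⊑ qual clause ∘ glb ds
        head-match : X ≡ head clause ⟪ θ ⟫ₐ
        steps      : n ≡ nL + (suc m + nR)

    select : ∀ xs {X d ys n} → DerivesAll P (xs ++ (X , d) ∷ ys) n → SelectedDerivation xs X d ys n
    select xs da with DerivesAll-++⁻ xs da
    ... | nL , _ , dxs , infer {C} {θ} {ds = ds} {m} C∈P ps d⊑ ∷ dys , refl = record
      { clause = C ; clause∈P = C∈P ; θ = θ ; ds = ds ; m = m ; nL = nL ; nR = _
      ; left = dxs ; premises = ps ; right = dys ; qual-bound = d⊑ ; head-match = refl ; steps = refl }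

  ∈⇒countThr-positive : ∀ {α W β} Δ → thr α W β ∈ Δ → 0 < countThr W Δ
  ∈⇒countThr-positive {W = W} (thr α V β ∷ Δ) p with W ≟ V | p
  ... | yes _  | _         = s≤s z≤n
  ... | no W≢V | here refl = ⊥-elim (W≢V refl)
  ... | no _   | there p′  = ∈⇒countThr-positive Δ p′
  ∈⇒countThr-positive (def _ _ _ ∷ Δ) (there p) = ∈⇒countThr-positive Δ p

  record ThresholdOf (W : QVar) (Δ : List Constraint) : Set where
    field
      α β    : D
      Δl Δr  : List Constraint
      split  : Δ ≡ Δl ++ thr α W β ∷ Δr
      unique : ∀ {α′ β′} → thr α′ W β′ ∉ Δl ++ Δr

  ThresholdOf-∷ : ∀ {W Δ} c → (∀ {α′ β′} → c ≢ thr α′ W β′) → ThresholdOf W Δ → ThresholdOf W (c ∷ Δ)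
  ThresholdOf-∷ c c≢thr T = record
    { α = α ; β = β ; Δl = c ∷ Δl ; Δr = Δr ; split = cong (c ∷_) split
    ; unique = λ { (here thr≡c) → c≢thr (sym thr≡c) ; (there p) → unique p } }
    where open ThresholdOf T

  thresholdOf : ∀ W Δ → countThr W Δ ≡ 1 → ThresholdOf W Δ
  thresholdOf W (thr α V β ∷ Δ) once with W ≟ V
  ... | yes refl = record
    { α = α ; β = β ; Δl = [] ; Δr = Δ ; split = refl
    ; unique = λ p → <-irrefl (sym (suc-injective once)) (∈⇒countThr-positive Δ p) }
  ... | no W≢V = ThresholdOf-∷ (thr α V β) (λ { refl → W≢V refl }) (thresholdOf W Δ once)
  thresholdOf W (def V e Us ∷ Δ) once = ThresholdOf-∷ (def V e Us) (λ ()) (thresholdOf W Δ once)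

  ∈⇒countDef-positive : ∀ {V e Us} Δ → def V e Us ∈ Δ → 0 < countDef V Δ
  ∈⇒countDef-positive {V = V} (def U e Us ∷ Δ) p with V ≟ U | p
  ... | yes _  | _         = s≤s z≤n
  ... | no V≢U | here refl = ⊥-elim (V≢U refl)
  ... | no _   | there p′  = ∈⇒countDef-positive Δ p′
  ∈⇒countDef-positive (thr _ _ _ ∷ Δ) (there p) = ∈⇒countDef-positive Δ p

  lookupDef : QVar → List Constraint → Maybe (D × List QVar)
  lookupDef V []                = nothing
  lookupDef V (thr _ _ _ ∷ Δ)   = lookupDef V Δ
  lookupDef V (def U e Us ∷ Δ) with V ≟ U
  ... | yes _ = just (e , Us)
  ... | no _  = lookupDef V Δ

  lookupDef-sound : ∀ {V e Us} Δ → lookupDef V Δ ≡ just (e , Us) → def V e Us ∈ Δ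
  lookupDef-sound (thr _ _ _ ∷ Δ) eq = there (lookupDef-sound Δ eq)
  lookupDef-sound {V} (def U e Us ∷ Δ) eq with V ≟ U | eq
  ... | yes refl | refl = here refl
  ... | no _     | eq′  = there (lookupDef-sound Δ eq′)

  lookupDef-complete : ∀ {V e Us} Δ → countDef V Δ ≤ 1 → def V e Us ∈ Δ → lookupDef V Δ ≡ just (e , Us)
  lookupDef-complete (thr _ _ _ ∷ Δ) once (there p) = lookupDef-complete Δ once p
  lookupDef-complete {V} (def U e Us ∷ Δ) once p with V ≟ U | p
  ... | yes _    | here refl = refl
  ... | yes _    | there p′  = ⊥-elim (<-irrefl refl (≤-trans (s≤s (∈⇒countDef-positive Δ p′)) once))
  ... | no V≢U   | here refl = ⊥-elim (V≢U refl)
  ... | no _     | there p′  = lookupDef-complete Δ once p′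

  -- close ρ keeps ρ on undefined variables and solves the defining constraints above them: the
  -- definition of V mentions only variables of smaller rank, so rank V + 1 rounds of evaluation fix V.
  module DefiningClosure (Δ : List Constraint) (rank : QVar → ℕ)
                         (acyclic : ∀ W d Ws → def W d Ws ∈ Δ → ∀ V → V ∈ Ws → rank V < rank W) where

    iterate : Valuation → ℕ → Valuation
    iterate ρ zero    = ρ
    iterate ρ (suc k) V with lookupDef V Δ
    ... | just (e , Us) = e ∘ glb (map (iterate ρ k) Us)
    ... | nothing       = ρ V

    iterate-stable : ∀ ρ j k V → rank V < j → rank V < k → iterate ρ j V ≡ iterate ρ k V
    iterate-stable ρ (suc j) (suc k) V (s≤s rV≤j) (s≤s rV≤k) with lookupDef V Δ in eq
    ... | just (e , Us) = cong (λ ds → e ∘ glb ds) (map-cong-local (All.tabulate λ {U} U∈Us →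
            let rU<rV = acyclic V e Us (lookupDef-sound Δ eq) U U∈Us in
            iterate-stable ρ j k U (<-≤-trans rU<rV rV≤j) (<-≤-trans rU<rV rV≤k)))
    ... | nothing = refl

    close : Valuation → Valuation
    close ρ V = iterate ρ (suc (rank V)) V

    close-undefined : ∀ ρ {V} → (∀ {e Us} → def V e Us ∉ Δ) → close ρ V ≡ ρ V
    close-undefined ρ {V} undefined with lookupDef V Δ in eq
    ... | just _  = ⊥-elim (undefined (lookupDef-sound Δ eq))
    ... | nothing = refl

    close-defined : ∀ ρ {V e Us} → countDef V Δ ≤ 1 → def V e Us ∈ Δ → close ρ V ≡ e ∘ glb (map (close ρ) Us)
    close-defined ρ {V} {e} {Us} once def∈Δ rewrite lookupDef-complete Δ once def∈Δ =
      cong (λ ds → e ∘ glb ds) (map-cong-local (All.tabulate λ {U} U∈Us →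
        iterate-stable ρ (rank V) (suc (rank U)) U (acyclic V e Us def∈Δ U U∈Us) ≤-refl))

    close-mono : ∀ {ρ₀ ρ} (S : QVar → Set) → (∀ {V e Us} → def V e Us ∈ Δ → S V → All S Us) →
                 SatAll ρ₀ Δ → (∀ {V} → S V → ρ₀ V ⊑ ρ V) → ∀ {V} → S V → ρ₀ V ⊑ close ρ V
    close-mono {ρ₀} {ρ} S closed sat₀ base = iterate-mono _
      where
      iterate-mono : ∀ k {V} → S V → ρ₀ V ⊑ iterate ρ k V
      iterate-mono zero    SV = base SV
      iterate-mono (suc k) {V} SV with lookupDef V Δ in eq
      ... | just (e , Us) = ⊑-trans (⊑-reflexive (All.lookup sat₀ (lookupDef-sound Δ eq)))
              (∘-mono ⊑-refl (glb-mono Us (All.map (iterate-mono k) (closed (lookupDef-sound Δ eq) SV))))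
      ... | nothing = base SV

  -- Lifting one inference step of a solution to a resolution step

  module Lifting (P : Program) (n : ℕ) (G₀ : Goal) (isGoal : IsGoal G₀)
                 (θ₀ : Subst) (ρ₀ : Valuation)
                 (θ₀-fixes : θ₀ ≐ (Goal.subst G₀ ⨾ θ₀)) (sat₀ : SatAll ρ₀ (cstrs G₀))
                 (derivs₀ : DerivesAll P (inst θ₀ ρ₀ (atoms G₀)) n)
                 (V₀ : List Var) (var⊆V₀ : ∀ x → x ∈var G₀ → x ∈ V₀) (dom⊆V₀ : ∀ x → x ∈dom θ₀ → x ∈ V₀)
                 (L : List AnnAtom) (A : Atom) (W : QVar) (R : List AnnAtom)
                 (selected : atoms G₀ ≡ L ++ (A , W) ∷ R) where

    σ₀ : Subst
    σ₀ = Goal.subst G₀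

    Δ : List Constraint
    Δ = cstrs G₀

    open IsGoal isGoal
    open Admissible admissible

    ∈-selected : ∀ {a} → a ∈ L ++ (A , W) ∷ R → a ∈ atoms G₀
    ∈-selected {a} = ≡.subst (a ∈_) (sym selected)

    selected-derivation : SelectedDerivation (inst θ₀ ρ₀ L) (A ⟪ θ₀ ⟫ₐ) (ρ₀ W) (inst θ₀ ρ₀ R) n
    selected-derivation = select (inst θ₀ ρ₀ L) (≡.subst (λ xs → DerivesAll P xs n) split-inst derivs₀)
      where
      split-inst : inst θ₀ ρ₀ (atoms G₀) ≡ inst θ₀ ρ₀ L ++ (A ⟪ θ₀ ⟫ₐ , ρ₀ W) ∷ inst θ₀ ρ₀ R
      split-inst = trans (cong (inst θ₀ ρ₀) selected) (map-++ _ L _)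

    open SelectedDerivation selected-derivation renaming (clause to C; clause∈P to C∈P; θ to θc)

    d : D
    d = qual C

    W∈qvars : W ∈ qvars (atoms G₀)
    W∈qvars = ∈-map⁺ proj₂ (∈-selected (∈-++⁺ʳ L (here refl)))

    open ThresholdOf (thresholdOf W Δ (thr-one W W∈qvars))

    -- N exceeds V₀ and every variable in the range of σ₀, so the shift N + _ renames C apart
    -- from G₀ and θ₁ can agree with θ₀ below N and with the shifted θc above it.
    N : ℕ
    N = above (V₀ ++ concat (map (λ y → vars (σ₀ y)) (proj₁ findom)))

    C′ : Clause
    C′ = renameClause (N +_) C

    θ₁ : Subst
    θ₁ = splice N (above (varsᶜ C)) θ₀ θc

    θ₁-finite : FinDom θ₁
    θ₁-finite = splice-FinDom {N} {above (varsᶜ C)} {θ₀} {θc} (V₀ , dom⊆V₀)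

    V₀-below : ∀ {x} → x ∈ V₀ → x < N
    V₀-below x∈V₀ = ∈⇒<above (∈-++⁺ˡ x∈V₀)

    θ₁-V₀ : ∀ x → x ∈ V₀ → θ₁ x ≡ θ₀ x
    θ₁-V₀ x x∈V₀ = splice-below (V₀-below x∈V₀)

    θ₁-var : ∀ x → x ∈var G₀ → θ₁ x ≡ θ₀ x
    θ₁-var x x∈G₀ = θ₁-V₀ x (var⊆V₀ x x∈G₀)

    θ₁-renamed : ∀ B → (∀ {y} → y occursInₐ B → y occursInᶜ C) → B ⟪ (λ y → var (N + y)) ⟫ₐ ⟪ θ₁ ⟫ₐ ≡ B ⟪ θc ⟫ₐ
    θ₁-renamed B B⊆C = trans (⟪⟫ₐ-⨾ B _ θ₁)
      (⟪⟫ₐ-cong B (λ y y∈B → splice-shifted {N} {above (varsᶜ C)} {θ₀} {θc} (∈⇒<above (occursᶜ⇒∈varsᶜ C (B⊆C y∈B)))))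

    C′-fresh : ∀ x → x occursInᶜ C′ → ¬ (x ∈var G₀)
    C′-fresh x x∈C′ x∈G₀ with occurs-renameClause (N +_) C x∈C′
    ... | y , _ , refl = <-irrefl refl (<-≤-trans (V₀-below (var⊆V₀ x x∈G₀)) (m≤m+n N y))

    θ₁-unifies : A ⟪ θ₁ ⟫ₐ ≡ head C′ ⟪ θ₁ ⟫ₐ
    θ₁-unifies = begin
      A ⟪ θ₁ ⟫ₐ        ≡⟨ ⟪⟫ₐ-cong A (λ x x∈A → θ₁-var x (inj₁ (lose (∈-selected (∈-++⁺ʳ L (here refl))) x∈A))) ⟩
      A ⟪ θ₀ ⟫ₐ        ≡⟨ head-match ⟩
      head C ⟪ θc ⟫ₐ   ≡⟨ θ₁-renamed (head C) inj₁ ⟨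
      head C′ ⟪ θ₁ ⟫ₐ  ∎
      where open ≡-Reasoning

    open MostGeneralUnifier (unify A (head C′) θ₁-unifies) public renaming (mgu to σ₁)

    σ₁⨾θ₁≐θ₁ : (σ₁ ⨾ θ₁) ≐ θ₁
    σ₁⨾θ₁≐θ₁ y = sym (factors y)

    σ₀⨾θ₁≐θ₁ : (σ₀ ⨾ θ₁) ≐ θ₁
    σ₀⨾θ₁≐θ₁ y with σ₀ y ≟var y
    ... | yes σ₀y≡y = cong (_⟪ θ₁ ⟫) σ₀y≡y
    ... | no y∈dom = begin
      σ₀ y ⟪ θ₁ ⟫  ≡⟨ ⟪⟫-cong (σ₀ y) (λ x x∈σ₀y → splice-below (∈⇒<above (∈-++⁺ʳ V₀
                          (∈-concat⁺′ (occurs⇒∈vars (σ₀ y) x∈σ₀y) (∈-map⁺ (λ z → vars (σ₀ z)) (proj₂ findom y y∈dom)))))) ⟩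
      σ₀ y ⟪ θ₀ ⟫  ≡⟨ θ₀-fixes y ⟨
      θ₀ y         ≡⟨ θ₁-var y (inj₂ y∈dom) ⟨
      θ₁ y         ∎
      where open ≡-Reasoning

    σ₀⨾σ₁⨾θ₁≐θ₁ : ((σ₀ ⨾ σ₁) ⨾ θ₁) ≐ θ₁
    σ₀⨾σ₁⨾θ₁≐θ₁ y = trans (⟪⟫-absorb (σ₀ y) σ₁⨾θ₁≐θ₁) (σ₀⨾θ₁≐θ₁ y)

    Mq : ℕ
    Mq = above (qvars (atoms G₀) ++ concat (map cvars Δ))

    war-below : ∀ {V} → V ∈war G₀ → V < Mq
    war-below (inj₁ V∈atoms) = ∈⇒<above (∈-++⁺ˡ V∈atoms)
    war-below (inj₂ V∈Δ)     = ∈⇒<above (∈-++⁺ʳ (qvars (atoms G₀)) (∈-concat⁺ (Any.map⁺ V∈Δ)))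

    Ws : List QVar
    Ws = applyUpTo (Mq +_) (length (body C′))

    Ws-fresh : ∀ V → V ∈ Ws → ¬ (V ∈war G₀)
    Ws-fresh V V∈Ws V∈G₀ = <-irrefl refl (<-≤-trans (war-below V∈G₀) (∈-applyUpTo-+⁻ V∈Ws))

    Ws-length : length Ws ≡ length ds
    Ws-length = trans (length-applyUpTo _ _) (trans (length-map _ (body C)) (sym (Premises-length premises)))

    W∉Ws : W ∉ Ws
    W∉Ws W∈Ws = Ws-fresh W W∈Ws (inj₁ W∈qvars)

    ρ′ : Valuation
    ρ′ = (ρ₀ [ Ws ≔* ds ]) [ W ≔ d ∘ glb ds ]

    open DefiningClosure Δ (proj₁ acyclic) (proj₂ acyclic)

    ρ₁ : Valuation
    ρ₁ = close ρ′

    war-undefined : ∀ {V e Us} → ¬ (V ∈war G₀) → def V e Us ∉ Δ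
    war-undefined V∉G₀ def∈Δ = V∉G₀ (inj₂ (lose def∈Δ (here refl)))

    qvars-undefined : ∀ {V e Us} → V ∈ qvars (atoms G₀) → def V e Us ∉ Δ
    qvars-undefined V∈atoms def∈Δ = <-irrefl (sym (def-notA _ V∈atoms)) (∈⇒countDef-positive Δ def∈Δ)

    ρ₁-W : ρ₁ W ≡ d ∘ glb ds
    ρ₁-W = trans (close-undefined ρ′ (qvars-undefined W∈qvars)) (≔-same (ρ₀ [ Ws ≔* ds ]) W (d ∘ glb ds))

    ρ₁-Ws : map ρ₁ Ws ≡ ds
    ρ₁-Ws = trans (map-cong-local (All.tabulate λ {V} V∈Ws →
                     trans (close-undefined ρ′ (war-undefined (Ws-fresh V V∈Ws)))
                           (≔-other (ρ₀ [ Ws ≔* ds ]) (d ∘ glb ds) λ { refl → W∉Ws V∈Ws })))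
                  (≔*-map ρ₀ Ws ds (applyUpTo-+-unique Mq _) Ws-length)

    ρ₁-qvars : ∀ {V} → V ∈ qvars (atoms G₀) → V ≢ W → ρ₁ V ≡ ρ₀ V
    ρ₁-qvars {V} V∈atoms V≢W = begin
      close ρ′ V              ≡⟨ close-undefined ρ′ (qvars-undefined V∈atoms) ⟩
      ρ′ V                    ≡⟨ ≔-other (ρ₀ [ Ws ≔* ds ]) (d ∘ glb ds) V≢W ⟩
      (ρ₀ [ Ws ≔* ds ]) V     ≡⟨ ≔*-∉ ρ₀ Ws ds (λ V∈Ws → Ws-fresh V V∈Ws (inj₁ V∈atoms)) ⟩
      ρ₀ V                    ∎
      where open ≡-Reasoning

    ρ₁-mono : ∀ V → V ∈war G₀ → ρ₀ V ⊑ ρ₁ V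
    ρ₁-mono V = close-mono (_∈war G₀) (λ def∈Δ _ → All.tabulate λ U∈Us → inj₂ (lose def∈Δ (there U∈Us))) sat₀ below-ρ′
      where
      below-ρ′ : ∀ {V} → V ∈war G₀ → ρ₀ V ⊑ ρ′ V
      below-ρ′ {V} V∈G₀ with V ≟ W
      ... | yes refl = qual-bound
      ... | no _     = ⊑-reflexive (sym (≔*-∉ ρ₀ Ws ds (λ V∈Ws → Ws-fresh V V∈Ws V∈G₀)))

    β⊑α∘d∘glb : β ⊑ α ∘ (d ∘ glb ds)
    β⊑α∘d∘glb = ⊑-trans (All.lookup sat₀ (≡.subst (thr α W β ∈_) (sym split) (∈-++⁺ʳ Δl (here refl))))
                        (∘-mono ⊑-refl qual-bound)

    β⊑d∘α : β ⊑ d ∘ α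
    β⊑d∘α = ⊑-trans β⊑α∘d∘glb (⊑-trans (∘-mono ⊑-refl (∘-⊑ˡ d (glb ds))) (⊑-reflexive (∘-comm α d)))

    β⊑d∘α∘ds : ∀ {e} → e ∈ ds → β ⊑ (d ∘ α) ∘ e
    β⊑d∘α∘ds {e} e∈ds = ⊑-trans β⊑α∘d∘glb (⊑-trans (∘-mono ⊑-refl (∘-mono ⊑-refl (glb-lower ds e∈ds)))
                          (⊑-reflexive (trans (sym (∘-assoc α d e)) (cong (_∘ e) (∘-comm α d)))))

    Δ₁ : List Constraint
    Δ₁ = map (λ V → thr (d ∘ α) V β) Ws ++ def W d Ws ∷ Δl ++ Δr

    sat₁ : SatAll ρ₁ Δ₁
    sat₁ = ++⁺ (map⁺ (All.tabulate λ {V} V∈Ws → β⊑d∘α∘ds (≡.subst (ρ₁ V ∈_) ρ₁-Ws (∈-map⁺ ρ₁ V∈Ws))))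
               (trans ρ₁-W (cong (λ es → d ∘ glb es) (sym ρ₁-Ws)) ∷ All.tabulate sat-rest)
      where
      ∈-Δ : ∀ {c} → c ∈ Δl ++ Δr → c ∈ Δ
      ∈-Δ {c} c∈ with ∈-++⁻ Δl c∈
      ... | inj₁ c∈Δl = ≡.subst (c ∈_) (sym split) (∈-++⁺ˡ c∈Δl)
      ... | inj₂ c∈Δr = ≡.subst (c ∈_) (sym split) (∈-++⁺ʳ Δl (there c∈Δr))

      sat-rest : ∀ {c} → c ∈ Δl ++ Δr → Sat ρ₁ c
      sat-rest {thr α′ V β′} c∈ = ≡.subst (λ e → β′ ⊑ α′ ∘ e) (sym (ρ₁-qvars (thr-only α′ V β′ (∈-Δ c∈)) V≢W))
                                        (All.lookup sat₀ (∈-Δ c∈))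
        where
        V≢W : V ≢ W
        V≢W refl = unique c∈
      sat-rest {def V e Us} c∈ = close-defined ρ′ (def-once V) (∈-Δ c∈)

    W-selected-only : W ∉ qvars L ++ qvars R
    W-selected-only = Unique-∉ (qvars L) (qvars R)
      (≡.subst Unique (trans (cong qvars selected) (map-++ proj₂ L _)) qdistinct)

    unselected-unchanged : ∀ {a} → a ∈ atoms G₀ → proj₂ a ∈ qvars L ++ qvars R →
                           proj₁ a ⟪ θ₁ ⟫ₐ ≡ proj₁ a ⟪ θ₀ ⟫ₐ × ρ₁ (proj₂ a) ≡ ρ₀ (proj₂ a)
    unselected-unchanged {a} a∈G₀ V∈LR =
      ⟪⟫ₐ-cong (proj₁ a) (λ x x∈a → θ₁-var x (inj₁ (lose a∈G₀ x∈a))) ,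
      ρ₁-qvars (∈-map⁺ proj₂ a∈G₀) (λ { refl → W-selected-only V∈LR })

    L-unchanged : inst θ₁ ρ₁ L ≡ inst θ₀ ρ₀ L
    L-unchanged = inst-cong L (All.tabulate λ a∈L →
      unselected-unchanged (∈-selected (∈-++⁺ˡ a∈L)) (∈-++⁺ˡ (∈-map⁺ proj₂ a∈L)))

    R-unchanged : inst θ₁ ρ₁ R ≡ inst θ₀ ρ₀ R
    R-unchanged = inst-cong R (All.tabulate λ a∈R →
      unselected-unchanged (∈-selected (∈-++⁺ʳ L (there a∈R))) (∈-++⁺ʳ (qvars L) (∈-map⁺ proj₂ a∈R)))

    body-instance : inst θ₁ ρ₁ (zip (body C′) Ws) ≡ zip (map (_⟪ θc ⟫ₐ) (body C)) ds
    body-instance = trans (inst-zip θ₁ ρ₁ (body C′) Ws) (cong₂ zip renamed-body ρ₁-Ws)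
      where
      renamed-body : map (_⟪ θ₁ ⟫ₐ) (body C′) ≡ map (_⟪ θc ⟫ₐ) (body C)
      renamed-body = trans (sym (map-∘ (body C)))
        (map-cong-local (All.tabulate λ {B} B∈C → θ₁-renamed B (λ y∈B → inj₂ (lose B∈C y∈B))))

    G₁ : Goal
    G₁ = ⟨ applyAnn (L ++ zip (body C′) Ws ++ R) σ₁ ∣ σ₀ ⨾ σ₁ ∣ Δ₁ ⟩

    derivs₁ : DerivesAll P (inst θ₁ ρ₁ (atoms G₁)) (n ∸ 1)
    derivs₁ = ≡.subst₂ (DerivesAll P) (sym instance₁) (sym steps₁)
      (DerivesAll-++⁺ (≡.subst (λ xs → DerivesAll P xs nL) (sym L-unchanged) left)
        (DerivesAll-++⁺ (≡.subst (λ xs → DerivesAll P xs m) (sym body-instance) (Premises⇒DerivesAll premises))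
                        (≡.subst (λ xs → DerivesAll P xs nR) (sym R-unchanged) right)))
      where
      open ≡-Reasoning
      instance₁ : inst θ₁ ρ₁ (atoms G₁) ≡ inst θ₁ ρ₁ L ++ inst θ₁ ρ₁ (zip (body C′) Ws) ++ inst θ₁ ρ₁ R
      instance₁ = begin
        inst θ₁ ρ₁ (applyAnn (L ++ zip (body C′) Ws ++ R) σ₁)    ≡⟨ inst-applyAnn ρ₁ σ₁⨾θ₁≐θ₁ _ ⟩
        inst θ₁ ρ₁ (L ++ zip (body C′) Ws ++ R)                  ≡⟨ map-++ _ L _ ⟩
        inst θ₁ ρ₁ L ++ inst θ₁ ρ₁ (zip (body C′) Ws ++ R)       ≡⟨ cong (inst θ₁ ρ₁ L ++_) (map-++ _ (zip (body C′) Ws) R) ⟩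
        inst θ₁ ρ₁ L ++ inst θ₁ ρ₁ (zip (body C′) Ws) ++ inst θ₁ ρ₁ R ∎
      steps₁ : n ∸ 1 ≡ nL + (m + nR)
      steps₁ = cong (_∸ 1) (trans steps (+-suc nL (m + nR)))

    step : ResolutionStep P G₀ L A W R σ₁ G₁
    step = record
      { selected = selected ; α = α ; β = β ; Δl = Δl ; Δr = Δr ; split = split
      ; C = C ; C′ = C′ ; C∈P = C∈P ; variant = (N +_) , (λ {x} {y} → +-cancelˡ-≡ N x y) , refl
      ; fresh = C′-fresh ; d∘α⊒β = β⊑d∘α ; mgu = isMGU ; mgu-fin = finite
      ; Ws = Ws ; Ws-len = length-applyUpTo _ _ ; Ws-uniq = applyUpTo-+-unique Mq _ ; Ws-fresh = Ws-fresh
      ; result = refl }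

lemma2 : (𝒟 : QDomain) → let open QLP 𝒟 in
         (P : Program) (n : ℕ) (G₀ : Goal) → IsGoal G₀ → ¬ Solved G₀ →
         (θ₀ : Subst) (ρ₀ : Valuation) →
         θ₀ ≐ (subst G₀ ⨾ θ₀) → SatAll ρ₀ (cstrs G₀) →
         DerivesAll P (inst θ₀ ρ₀ (atoms G₀)) n →
         (V₀ : List Var) → (∀ x → x ∈var G₀ → x ∈ V₀) → (∀ x → x ∈dom θ₀ → x ∈ V₀) →
         (L : List AnnAtom) (A : Atom) (W : QVar) (R : List AnnAtom) →
         atoms G₀ ≡ L ++ (A , W) ∷ R →
         Σ Subst λ σ₁ → Σ Goal λ G₁ → ResolutionStep P G₀ L A W R σ₁ G₁ ×
         Σ Subst λ θ₁ → Σ Valuation λ ρ₁ →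
           FinDom θ₁ ×
           (∀ x → x ∈ V₀ → θ₁ x ≡ θ₀ x) ×
           ((σ₁ ⨾ θ₁) ≐ θ₁) ×
           (((subst G₀ ⨾ σ₁) ⨾ θ₁) ≐ θ₁) ×
           (∀ W′ → W′ ∈war G₀ → ρ₀ W′ ⊑ ρ₁ W′) ×
           SatAll ρ₁ (cstrs G₁) ×
           DerivesAll P (inst θ₁ ρ₁ (atoms G₁)) (n ∸ 1)
lemma2 𝒟 P n G₀ isGoal _ θ₀ ρ₀ θ₀-fixes sat₀ derivs₀ V₀ var⊆V₀ dom⊆V₀ L A W R selected =
  σ₁ , G₁ , step , θ₁ , ρ₁ , θ₁-finite , θ₁-V₀ , σ₁⨾θ₁≐θ₁ , σ₀⨾σ₁⨾θ₁≐θ₁ , ρ₁-mono , sat₁ , derivs₁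
  where open Lifting {𝒟} P n G₀ isGoal θ₀ ρ₀ θ₀-fixes sat₀ derivs₀ V₀ var⊆V₀ dom⊆V₀ L A W R selected
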